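{- Let $x=(x_0,\dots,x_r)$ be indeterminates and let $y_0,\dots,y_r$ be the formal power series in $x$ with zero constant terms determined by $x_i=\frac{y_i(1+y_i)}{E(y)^2}$, where $E(y)=\prod_{j=0}^r(1+y_j)$. Let $A(y)=1-\sum_{i=0}^r\frac{y_i}{1+y_i}$ and $g_1=E(y)^2A(y)$. Define the operator $D_x=\sum_{i=0}^r x_i\frac{\partial}{\partial x_i}$ and let $I_x$ be the identity operator on $\mathbb{Q}[[x_0,\dots,x_r]]$. Then $$(D_x+I_x)(g_1)=E(y)^2.$$ -}

module Defs where

open import Data.Nat as ℕ using (ℕ; zero; suc)
open import Data.Fin using (Fin; zero; suc; _≟_)
open import Data.Vec as Vec using (Vec; []; _∷_)
open import Data.List as List using (List; []; _∷_)
open import Data.Product using (_×_; _,_)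
open import Data.Integer using (+_)
open import Data.Rational using (ℚ; 0ℚ; 1ℚ; _+_; _*_; -_; _/_)
open import Relation.Binary.PropositionalEquality using (_≡_)
open import Relation.Nullary using (yes; no)

-- Formal power series over ℚ in n indeterminates x_0..x_{n-1},
-- represented by their coefficient function on exponent vectors.
Mono : ℕ → Set
Mono n = Vec ℕ n

PS : ℕ → Set
PS n = Mono n → ℚ

_≈ₚ_ : ∀ {n} → PS n → PS n → Set
f ≈ₚ g = ∀ α → f α ≡ g α
infix 4 _≈ₚ_

sumL : List ℚ → ℚ
sumL = List.foldr _+_ 0ℚ

splits : ∀ {n} → Mono n → List (Mono n × Mono n)
splits [] = ([] , []) ∷ []
splits (a ∷ α) =
  List.concatMap (λ k → List.map (λ { (β , γ) → (k ∷ β , (a ℕ.∸ k) ∷ γ) }) (splits α))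
                 (List.upTo (suc a))

constₚ : ∀ {n} → ℚ → PS n
constₚ c α with Vec.sum α
... | zero = c
... | suc _ = 0ℚ

0ₚ 1ₚ : ∀ {n} → PS n
0ₚ = constₚ 0ℚ
1ₚ = constₚ 1ℚ

_+ₚ_ : ∀ {n} → PS n → PS n → PS n
(f +ₚ g) α = f α + g α

-ₚ_ : ∀ {n} → PS n → PS n
(-ₚ f) α = - f α

_-ₚ_ : ∀ {n} → PS n → PS n → PS n
f -ₚ g = f +ₚ (-ₚ g)

_*ₚ_ : ∀ {n} → PS n → PS n → PS n
(f *ₚ g) α = sumL (List.map (λ { (β , γ) → f β * g γ }) (splits α))

infixl 7 _*ₚ_
infixl 6 _+ₚ_ _-ₚ_

_^ₚ_ : ∀ {n} → PS n → ℕ → PS n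
f ^ₚ zero = 1ₚ
f ^ₚ suc k = f *ₚ (f ^ₚ k)

sumFin : ∀ {n m} → (Fin m → PS n) → PS n
sumFin {m = zero} f = 0ₚ
sumFin {m = suc m} f = f zero +ₚ sumFin (λ i → f (suc i))

prodFin : ∀ {n m} → (Fin m → PS n) → PS n
prodFin {m = zero} f = 1ₚ
prodFin {m = suc m} f = f zero *ₚ prodFin (λ i → f (suc i))

var : ∀ {n} → Fin n → PS n
var {zero} () α
var {suc n} zero (a ∷ α) with a | Vec.sum α
... | 1 | zero = 1ℚ
... | _ | _ = 0ℚ
var {suc n} (suc i) (zero ∷ α) = var i α
var {suc n} (suc i) (suc a ∷ α) = 0ℚ

ℕtoℚ : ℕ → ℚ
ℕtoℚ k = (+ k) / 1

∂ : ∀ {n} → Fin n → PS n → PS n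
∂ i f α = ℕtoℚ (suc (Vec.lookup α i)) * f (Vec.updateAt α i suc)

Dx : ∀ {n} → PS n → PS n
Dx f = sumFin (λ i → var i *ₚ ∂ i f)

Ix : ∀ {n} → PS n → PS n
Ix f = f

const-coeff : ∀ {n} → PS n → ℚ
const-coeff {n} f = f (Vec.replicate n 0)

-- multiplicative inverse of 1 + h for h with zero constant term:
-- (1 + h)⁻¹ = Σ_k (-h)^k ; only k ≤ |α| contribute to the coefficient of α.
inv1p : ∀ {n} → PS n → PS n
inv1p h α = sumL (List.map (λ k → ((-ₚ h) ^ₚ k) α) (List.upTo (suc (Vec.sum α))))

-- inverse of a power series with constant term 1
recipₚ : ∀ {n} → PS n → PS n
recipₚ f = inv1p (f -ₚ 1ₚ)

E : ∀ {n m} → (Fin m → PS n) → PS n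
E y = prodFin (λ j → 1ₚ +ₚ y j)

A : ∀ {n m} → (Fin m → PS n) → PS n
A y = 1ₚ -ₚ sumFin (λ i → y i *ₚ recipₚ (1ₚ +ₚ y i))

-- D_x multiplies the coefficient of x^α by the total degree |α|, so it is a derivation δ of
-- ℚ[[x]] with δ xᵢ = xᵢ, and the claim is an identity about derivations. Applying δ to
-- xᵢ E² = yᵢ (1 + yᵢ) gives δyᵢ (1 + 2yᵢ) = yᵢ (1 + yᵢ) B with B = 1 + δ(E²)/E² = 1 + 2S, where
-- S = δE/E = Σ δyᵢ/(1 + yᵢ). Hence S = B T and δA = -B T₂ with T = Σ yᵢ/(1 + 2yᵢ) and
-- T₂ = Σ yᵢ/((1 + yᵢ)(1 + 2yᵢ)); as T₁ + T₂ = 2T for T₁ = Σ yᵢ/(1 + yᵢ) = 1 - A, this gives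
-- (1 + 2S) A + δA = B (1 - 2T) = 1, i.e. δ(E²A) + E²A = E².
-- The ring laws of ℚ[[x₀,…,xₙ]] follow by induction on the number of variables, viewing a series
-- as the sequence of its x₀^a-coefficients under the Cauchy product; series with constant term 1
-- are inverted by truncated geometric series.

module Submission where

open import Defs
open import Data.Nat using (ℕ; suc)
open import Data.Fin using (Fin)
open import Data.Rational using (0ℚ)
open import Relation.Binary.PropositionalEquality using (_≡_)

open import Algebra using (CommutativeRing)
open import Algebra.Structures using (IsAbelianGroup; IsCommutativeRing)
open import Level using (0ℓ; _⊔_)
open import Function using (_∘_)
open import Data.Product using (_×_; _,_; proj₁; proj₂)
open import Data.Sum using (_⊎_; inj₁; inj₂)
open import Data.Nat as ℕ using (zero; _∸_; _≤_; s≤s)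
open import Data.Nat.Properties as ℕP using (m∸[m∸n]≡n)
open import Data.Fin as Fin using (toℕ; opposite)
open import Data.Fin.Properties using (toℕ≤pred[n]; opposite-prop)
import Data.Fin.Permutation as Perm
open import Data.Vec as Vec using ([]; _∷_)
open import Data.Vec.Functional as Vector using (Vector)
open import Data.List as List using (List; []; _∷_)
open import Data.List.Properties using (map-++; map-∘; map-cong)
open import Data.List.Relation.Unary.All as All using (All; []; _∷_)
open import Data.List.Relation.Unary.All.Properties using (concat⁺; map⁺; applyUpTo⁺₁)
import Data.Rational.Properties as ℚP
import Algebra.Properties.Semiring.Sum as SemiringSum
import Algebra.Properties.CommutativeSemigroup as CommutativeSemigroupProperties
import Algebra.Solver.Ring.NaturalCoefficients.Default as NatCoeffSolver
import Relation.Binary.Reasoning.Setoid as SetoidReasoning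
import Relation.Binary.PropositionalEquality as ≡

module Sequences {c ℓ} (R : CommutativeRing c ℓ) where
  open CommutativeRing R
  open SemiringSum semiring
  open SetoidReasoning setoid
  open NatCoeffSolver commutativeSemiring

  Σ< : ℕ → (ℕ → Carrier) → Carrier
  Σ< n F = ∑[ k < n ] F (toℕ k)

  Σ<-cong : ∀ n {F G : ℕ → Carrier} → (∀ k → F k ≈ G k) → Σ< n F ≈ Σ< n G
  Σ<-cong n F≈G = sum-cong-≋ {n} (λ k → F≈G (toℕ k))

  Σ<-zero : ∀ n (F : ℕ → Carrier) → (∀ k → F k ≈ 0#) → Σ< n F ≈ 0#
  Σ<-zero n F F≈0 = trans (Σ<-cong n F≈0) (sum-replicate-zero n)

  Σ<-truncate : ∀ m d (F : ℕ → Carrier) → (∀ k → m ≤ k → F k ≈ 0#) → Σ< (m ℕ.+ d) F ≈ Σ< m F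
  Σ<-truncate zero    d F F≈0 = Σ<-zero d F (λ k → F≈0 k ℕ.z≤n)
  Σ<-truncate (suc m) d F F≈0 = +-congˡ (Σ<-truncate m d (F ∘ suc) (λ k m≤k → F≈0 (suc k) (s≤s m≤k)))

  geometric-sum : ∀ u (U : ℕ → Carrier) → U 0 ≈ 1# → (∀ k → U (suc k) ≈ u * U k) →
                  ∀ M → (1# - u) * Σ< M U + U M ≈ 1#
  geometric-sum u U U0≈1 U′≈uU zero    = trans (+-cong (zeroʳ (1# - u)) U0≈1) (+-identityˡ 1#)
  geometric-sum u U U0≈1 U′≈uU (suc M) = begin
    (1# - u) * (U 0 + Σ< M (U ∘ suc)) + U (suc M)
      ≈⟨ +-cong (*-congˡ (+-cong U0≈1 Σ<U′≈uΣ<U)) (U′≈uU M) ⟩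
    (1# - u) * (1# + u * Σ< M U) + u * U M
      ≈⟨ solve 4 (λ w u′ s t → w :* (con 1 :+ u′ :* s) :+ u′ :* t := w :+ u′ :* (w :* s :+ t))
               refl (1# - u) u (Σ< M U) (U M) ⟩
    (1# - u) + u * ((1# - u) * Σ< M U + U M)
      ≈⟨ +-congˡ (trans (*-congˡ (geometric-sum u U U0≈1 U′≈uU M)) (*-identityʳ u)) ⟩
    (1# - u) + u
      ≈⟨ trans (+-assoc 1# (- u) u) (trans (+-congˡ (-‿inverseˡ u)) (+-identityʳ 1#)) ⟩
    1# ∎
    where
    Σ<U′≈uΣ<U : Σ< M (U ∘ suc) ≈ u * Σ< M U
    Σ<U′≈uΣ<U = trans (Σ<-cong M U′≈uU) (sym (*-distribˡ-sum {M} u (U ∘ toℕ)))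

  _⊛_ : (ℕ → Carrier) → (ℕ → Carrier) → ℕ → Carrier
  (f ⊛ g) a = Σ< (suc a) (λ k → f k * g (a ∸ k))

  ⊛-congˡ : ∀ {f f′} g → (∀ k → f k ≈ f′ k) → ∀ a → (f ⊛ g) a ≈ (f′ ⊛ g) a
  ⊛-congˡ g f≈f′ a = Σ<-cong (suc a) (λ k → *-congʳ {g (a ∸ k)} (f≈f′ k))

  ⊛-congʳ : ∀ f {g g′} → (∀ k → g k ≈ g′ k) → ∀ a → (f ⊛ g) a ≈ (f ⊛ g′) a
  ⊛-congʳ f g≈g′ a = Σ<-cong (suc a) (λ k → *-congˡ {f k} (g≈g′ (a ∸ k)))

  ⊛-comm : ∀ f g a → (f ⊛ g) a ≈ (g ⊛ f) a
  ⊛-comm f g a = begin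
    ∑[ k < suc a ] (f (toℕ k) * g (a ∸ toℕ k))
      ≈⟨ ∑-permute (λ k → f (toℕ k) * g (a ∸ toℕ k)) (Perm.reverse {suc a}) ⟩
    ∑[ k < suc a ] (f (toℕ (opposite k)) * g (a ∸ toℕ (opposite k)))
      ≈⟨ sum-cong-≋ {suc a} reflect ⟩
    ∑[ k < suc a ] (g (toℕ k) * f (a ∸ toℕ k)) ∎
    where
    reflect : ∀ (k : Fin (suc a)) → f (toℕ (opposite k)) * g (a ∸ toℕ (opposite k)) ≈ g (toℕ k) * f (a ∸ toℕ k)
    reflect k rewrite opposite-prop k | m∸[m∸n]≡n (toℕ≤pred[n] k) = *-comm _ _

  ⊛-distribʳ : ∀ f g h a → ((λ k → f k + g k) ⊛ h) a ≈ (f ⊛ h) a + (g ⊛ h) a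
  ⊛-distribʳ f g h a =
    trans (Σ<-cong (suc a) (λ k → distribʳ (h (a ∸ k)) (f k) (g k)))
          (∑-distrib-+ {suc a} (λ k → f (toℕ k) * h (a ∸ toℕ k)) (λ k → g (toℕ k) * h (a ∸ toℕ k)))

  ⊛-scaleˡ : ∀ x f h a → ((λ k → x * f k) ⊛ h) a ≈ x * (f ⊛ h) a
  ⊛-scaleˡ x f h a =
    trans (Σ<-cong (suc a) (λ k → *-assoc x (f k) (h (a ∸ k))))
          (sym (*-distribˡ-sum {suc a} x (λ k → f (toℕ k) * h (a ∸ toℕ k))))

  ⊛-assoc : ∀ f g h a → ((f ⊛ g) ⊛ h) a ≈ (f ⊛ (g ⊛ h)) a
  ⊛-assoc f g h zero    =
    solve 3 (λ x y z → (x :* y :+ con 0) :* z :+ con 0 := x :* (y :* z :+ con 0) :+ con 0) refl (f 0) (g 0) (h 0)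
  ⊛-assoc f g h (suc a) = begin
    (f ⊛ g) 0 * h (suc a) + (fg′ ⊛ h) a
      ≈⟨ +-congˡ (⊛-distribʳ (λ k → f 0 * g′ k) (f′ ⊛ g) h a) ⟩
    (f ⊛ g) 0 * h (suc a) + (((λ k → f 0 * g′ k) ⊛ h) a + ((f′ ⊛ g) ⊛ h) a)
      ≈⟨ +-congˡ (+-cong (⊛-scaleˡ (f 0) g′ h a) (⊛-assoc f′ g h a)) ⟩
    (f 0 * g 0 + 0#) * h (suc a) + (f 0 * (g′ ⊛ h) a + (f′ ⊛ (g ⊛ h)) a)
      ≈⟨ solve 5 (λ x y z u v → (x :* y :+ con 0) :* z :+ (x :* u :+ v) := x :* (y :* z :+ u) :+ v)
               refl (f 0) (g 0) (h (suc a)) ((g′ ⊛ h) a) ((f′ ⊛ (g ⊛ h)) a) ⟩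
    f 0 * (g 0 * h (suc a) + (g′ ⊛ h) a) + (f′ ⊛ (g ⊛ h)) a ∎
    where
    -- (f ⊛ g) (suc k) is by definition f 0 * g′ k + (f′ ⊛ g) k
    f′ g′ fg′ : ℕ → Carrier
    f′ k = f (suc k)
    g′ k = g (suc k)
    fg′ k = (f ⊛ g) (suc k)

  ⊛-zero : ∀ f g → (f ⊛ g) 0 ≈ f 0 * g 0
  ⊛-zero f g = +-identityʳ (f 0 * g 0)

  ⊛-shiftˡ : ∀ f g → f 0 ≈ 0# → ∀ a → (f ⊛ g) (suc a) ≈ ((f ∘ suc) ⊛ g) a
  ⊛-shiftˡ f g f0≈0 a = trans (+-congʳ (trans (*-congʳ f0≈0) (zeroˡ (g (suc a))))) (+-identityˡ _)

  ⊛-headˡ : ∀ e g → (∀ k → e (suc k) ≈ 0#) → ∀ a → (e ⊛ g) a ≈ e 0 * g a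
  ⊛-headˡ e g e′≈0 a =
    trans (+-congˡ (Σ<-zero a (λ k → e (suc k) * g (a ∸ suc k)) (λ k → trans (*-congʳ (e′≈0 k)) (zeroˡ _))))
          (+-identityʳ _)

  ⊛-identityˡ : ∀ e g → e 0 ≈ 1# → (∀ k → e (suc k) ≈ 0#) → ∀ a → (e ⊛ g) a ≈ g a
  ⊛-identityˡ e g e0≈1 e′≈0 a = trans (⊛-headˡ e g e′≈0 a) (trans (*-congʳ e0≈1) (*-identityˡ (g a)))

-- Derivations

record IsDerivation {c ℓ} (R : CommutativeRing c ℓ) (δ : CommutativeRing.Carrier R → CommutativeRing.Carrier R)
                    : Set (c ⊔ ℓ) where
  open CommutativeRing R
  field
    cong    : ∀ {x y} → x ≈ y → δ x ≈ δ y
    +-homo  : ∀ x y → δ (x + y) ≈ δ x + δ y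
    leibniz : ∀ x y → δ (x * y) ≈ δ x * y + x * δ y

module DerivationProperties {c ℓ} {R : CommutativeRing c ℓ} {δ} (isDerivation : IsDerivation R δ) where
  open CommutativeRing R
  open IsDerivation isDerivation
  open import Algebra.Properties.Ring ring using (x+x≈x⇒x≈0; +-inverseˡ-unique; +-cancelʳ)
  open SemiringSum semiring
  open SetoidReasoning setoid
  open NatCoeffSolver commutativeSemiring

  ∏ : ∀ {m} → Vector Carrier m → Carrier
  ∏ = Vector.foldr _*_ 1#

  δ-0 : δ 0# ≈ 0#
  δ-0 = x+x≈x⇒x≈0 (δ 0#) (trans (sym (+-homo 0# 0#)) (cong (+-identityˡ 0#)))

  δ-1 : δ 1# ≈ 0#
  δ-1 = x+x≈x⇒x≈0 (δ 1#) (begin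
    δ 1# + δ 1#            ≈⟨ +-cong (*-identityʳ (δ 1#)) (*-identityˡ (δ 1#)) ⟨
    δ 1# * 1# + 1# * δ 1#  ≈⟨ leibniz 1# 1# ⟨
    δ (1# * 1#)            ≈⟨ cong (*-identityˡ 1#) ⟩
    δ 1#                   ∎)

  δ-‿homo : ∀ x → δ (- x) ≈ - δ x
  δ-‿homo x = +-inverseˡ-unique (δ (- x)) (δ x) (trans (sym (+-homo (- x) x)) (trans (cong (-‿inverseˡ x)) δ-0))

  δ-1+ : ∀ x → δ (1# + x) ≈ δ x
  δ-1+ x = trans (+-homo 1# x) (trans (+-congʳ δ-1) (+-identityˡ (δ x)))

  δ-sum : ∀ {m} (f : Vector Carrier m) → δ (sum f) ≈ sum (δ ∘ f)
  δ-sum {zero}  f = δ-0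
  δ-sum {suc m} f = trans (+-homo (f Fin.zero) (sum (f ∘ Fin.suc))) (+-congˡ (δ-sum (f ∘ Fin.suc)))

  δ-∏ : ∀ {m} (q r : Vector Carrier m) → (∀ j → q j * r j ≈ 1#) → δ (∏ q) ≈ ∏ q * ∑[ j < m ] (δ (q j) * r j)
  δ-∏ {zero}  q r qr≈1 = trans δ-1 (sym (zeroʳ 1#))
  δ-∏ {suc m} q r qr≈1 = begin
    δ (q₀ * Π)
      ≈⟨ leibniz q₀ Π ⟩
    δ q₀ * Π + q₀ * δ Π
      ≈⟨ +-cong (sym (trans (*-congˡ (qr≈1 Fin.zero)) (*-identityʳ _)))
                (*-congˡ (δ-∏ (q ∘ Fin.suc) (r ∘ Fin.suc) (qr≈1 ∘ Fin.suc))) ⟩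
    (δ q₀ * Π) * (q₀ * r₀) + q₀ * (Π * S)
      ≈⟨ solve 5 (λ dq p q r s → (dq :* p) :* (q :* r) :+ q :* (p :* s) := (q :* p) :* (dq :* r :+ s))
               refl (δ q₀) Π q₀ r₀ S ⟩
    (q₀ * Π) * (δ q₀ * r₀ + S) ∎
    where
    q₀ r₀ Π S : Carrier
    q₀ = q Fin.zero
    r₀ = r Fin.zero
    Π = ∏ (q ∘ Fin.suc)
    S = ∑[ j < m ] (δ (q (Fin.suc j)) * r (Fin.suc j))

  δ[y*r]≈δy*r*r : ∀ {y r} → (1# + y) * r ≈ 1# → δ (y * r) ≈ δ y * r * r
  δ[y*r]≈δy*r*r {y} {r} [1+y]r≈1 = +-cancelʳ (δ r) (δ (y * r)) (δ y * r * r) (trans δ[yr]+δr≈0 (sym δyrr+δr≈0))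
    where
    δ[[1+y]*r]≈0 : δ y * r + (1# + y) * δ r ≈ 0#
    δ[[1+y]*r]≈0 = begin
      δ y * r + (1# + y) * δ r           ≈⟨ +-congʳ (*-congʳ (δ-1+ y)) ⟨
      δ (1# + y) * r + (1# + y) * δ r    ≈⟨ leibniz (1# + y) r ⟨
      δ ((1# + y) * r)                   ≈⟨ cong [1+y]r≈1 ⟩
      δ 1#                               ≈⟨ δ-1 ⟩
      0#                                 ∎
    δ[yr]+δr≈0 : δ (y * r) + δ r ≈ 0#
    δ[yr]+δr≈0 = begin
      δ (y * r) + δ r
        ≈⟨ +-congʳ (leibniz y r) ⟩
      (δ y * r + y * δ r) + δ r
        ≈⟨ solve 4 (λ dy r′ y′ dr → (dy :* r′ :+ y′ :* dr) :+ dr := dy :* r′ :+ (con 1 :+ y′) :* dr)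
                 refl (δ y) r y (δ r) ⟩
      δ y * r + (1# + y) * δ r
        ≈⟨ δ[[1+y]*r]≈0 ⟩
      0# ∎
    δyrr+δr≈0 : δ y * r * r + δ r ≈ 0#
    δyrr+δr≈0 = begin
      δ y * r * r + δ r
        ≈⟨ +-congˡ (trans (*-congˡ [1+y]r≈1) (*-identityʳ (δ r))) ⟨
      δ y * r * r + δ r * ((1# + y) * r)
        ≈⟨ solve 4 (λ dy r′ y′ dr → dy :* r′ :* r′ :+ dr :* ((con 1 :+ y′) :* r′) := (dy :* r′ :+ (con 1 :+ y′) :* dr) :* r′)
                 refl (δ y) r y (δ r) ⟩
      (δ y * r + (1# + y) * δ r) * r
        ≈⟨ *-congʳ δ[[1+y]*r]≈0 ⟩
      0# * r
        ≈⟨ zeroˡ r ⟩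
      0# ∎

module EulerIdentity {c ℓ} {R : CommutativeRing c ℓ} {δ} (isDerivation : IsDerivation R δ) where
  open CommutativeRing R
  open IsDerivation isDerivation
  open DerivationProperties isDerivation
  open import Algebra.Properties.Ring ring using (+-cancelʳ)
  open SemiringSum semiring
  open SetoidReasoning setoid
  open NatCoeffSolver commutativeSemiring

  module _ {m} (x y r v : Vector Carrier m)
    (r-inverse : ∀ i → (1# + y i) * r i ≈ 1#)
    (v-inverse : ∀ i → (1# + (y i + y i)) * v i ≈ 1#)
    (δx≈x : ∀ i → δ (x i) ≈ x i)
    (x*Ey²≈y*[1+y] : ∀ i → x i * (∏ (λ j → 1# + y j) * ∏ (λ j → 1# + y j)) ≈ y i * (1# + y i))
    where

    Q D : Vector Carrier m
    Q i = 1# + y i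
    D i = 1# + (y i + y i)

    -- S = δEy / Ey and B = 1 + δ(Ey²) / Ey²
    Ey Ey² S B T T₁ T₂ Ay : Carrier
    Ey  = ∏ Q
    Ey² = Ey * Ey
    S   = ∑[ i < m ] (δ (y i) * r i)
    B   = 1# + (S + S)
    T   = ∑[ i < m ] (y i * v i)
    T₁  = ∑[ i < m ] (y i * r i)
    T₂  = ∑[ i < m ] (y i * v i * r i)
    Ay  = 1# - T₁

    δEy≈Ey*S : δ Ey ≈ Ey * S
    δEy≈Ey*S = trans (δ-∏ Q r r-inverse) (*-congˡ (sum-cong-≋ {m} (λ i → *-congʳ (δ-1+ (y i)))))

    δEy²≈Ey²*[S+S] : δ Ey² ≈ Ey² * (S + S)
    δEy²≈Ey²*[S+S] = begin
      δ (Ey * Ey)                      ≈⟨ leibniz Ey Ey ⟩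
      δ Ey * Ey + Ey * δ Ey            ≈⟨ +-cong (*-congʳ δEy≈Ey*S) (*-congˡ δEy≈Ey*S) ⟩
      (Ey * S) * Ey + Ey * (Ey * S)    ≈⟨ solve 2 (λ e s → (e :* s) :* e :+ e :* (e :* s) := (e :* e) :* (s :+ s)) refl Ey S ⟩
      Ey² * (S + S)                    ∎

    -- δ applied to xᵢ Ey² = yᵢ (1 + yᵢ)
    y*Q*B≈δy*D : ∀ i → y i * Q i * B ≈ δ (y i) * D i
    y*Q*B≈δy*D i = begin
      y i * Q i * B
        ≈⟨ *-congʳ (x*Ey²≈y*[1+y] i) ⟨
      x i * Ey² * B
        ≈⟨ solve 3 (λ x′ p s → x′ :* p :* (con 1 :+ (s :+ s)) := x′ :* p :+ x′ :* (p :* (s :+ s))) refl (x i) Ey² S ⟩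
      x i * Ey² + x i * (Ey² * (S + S))
        ≈⟨ +-cong (*-congʳ (δx≈x i)) (*-congˡ δEy²≈Ey²*[S+S]) ⟨
      δ (x i) * Ey² + x i * δ Ey²
        ≈⟨ leibniz (x i) Ey² ⟨
      δ (x i * Ey²)
        ≈⟨ cong (x*Ey²≈y*[1+y] i) ⟩
      δ (y i * Q i)
        ≈⟨ leibniz (y i) (Q i) ⟩
      δ (y i) * Q i + y i * δ (Q i)
        ≈⟨ +-congˡ (*-congˡ (δ-1+ (y i))) ⟩
      δ (y i) * Q i + y i * δ (y i)
        ≈⟨ solve 2 (λ dy y′ → dy :* (con 1 :+ y′) :+ y′ :* dy := dy :* (con 1 :+ (y′ :+ y′))) refl (δ (y i)) (y i) ⟩
      δ (y i) * D i ∎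

    δy*r≈B*[y*v] : ∀ i → δ (y i) * r i ≈ B * (y i * v i)
    δy*r≈B*[y*v] i = begin
      δ (y i) * r i
        ≈⟨ *-congʳ (trans (*-congˡ (v-inverse i)) (*-identityʳ (δ (y i)))) ⟨
      δ (y i) * (D i * v i) * r i
        ≈⟨ *-congʳ (*-assoc (δ (y i)) (D i) (v i)) ⟨
      δ (y i) * D i * v i * r i
        ≈⟨ *-congʳ (*-congʳ (y*Q*B≈δy*D i)) ⟨
      y i * Q i * B * v i * r i
        ≈⟨ solve 5 (λ y′ q b v′ r′ → y′ :* q :* b :* v′ :* r′ := b :* (y′ :* v′) :* (q :* r′)) refl (y i) (Q i) B (v i) (r i) ⟩
      B * (y i * v i) * (Q i * r i)
        ≈⟨ trans (*-congˡ (r-inverse i)) (*-identityʳ _) ⟩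
      B * (y i * v i) ∎

    S≈B*T : S ≈ B * T
    S≈B*T = trans (sum-cong-≋ {m} δy*r≈B*[y*v]) (sym (*-distribˡ-sum {m} B (λ i → y i * v i)))

    δT₁≈B*T₂ : δ T₁ ≈ B * T₂
    δT₁≈B*T₂ = begin
      δ T₁                                ≈⟨ δ-sum (λ i → y i * r i) ⟩
      ∑[ i < m ] δ (y i * r i)            ≈⟨ sum-cong-≋ {m} (λ i → δ[y*r]≈δy*r*r (r-inverse i)) ⟩
      ∑[ i < m ] (δ (y i) * r i * r i)    ≈⟨ sum-cong-≋ {m} (λ i → trans (*-congʳ (δy*r≈B*[y*v] i)) (*-assoc B _ _)) ⟩
      ∑[ i < m ] (B * (y i * v i * r i))  ≈⟨ *-distribˡ-sum {m} B (λ i → y i * v i * r i) ⟨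
      B * T₂                              ∎

    y*r+y*v*r≈y*v+y*v : ∀ i → y i * r i + y i * v i * r i ≈ y i * v i + y i * v i
    y*r+y*v*r≈y*v+y*v i = sym (begin
      y i * v i + y i * v i
        ≈⟨ trans (*-congˡ (r-inverse i)) (*-identityʳ _) ⟨
      (y i * v i + y i * v i) * (Q i * r i)
        ≈⟨ solve 3 (λ y′ v′ r′ → (y′ :* v′ :+ y′ :* v′) :* ((con 1 :+ y′) :* r′)
                                  := y′ :* r′ :* ((con 1 :+ (y′ :+ y′)) :* v′) :+ y′ :* v′ :* r′ :* con 1)
                 refl (y i) (v i) (r i) ⟩
      y i * r i * (D i * v i) + y i * v i * r i * 1#
        ≈⟨ +-cong (trans (*-congˡ (v-inverse i)) (*-identityʳ _)) (*-identityʳ _) ⟩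
      y i * r i + y i * v i * r i ∎)

    T₁+T₂≈T+T : T₁ + T₂ ≈ T + T
    T₁+T₂≈T+T = begin
      T₁ + T₂                                   ≈⟨ ∑-distrib-+ {m} (λ i → y i * r i) (λ i → y i * v i * r i) ⟨
      ∑[ i < m ] (y i * r i + y i * v i * r i)  ≈⟨ sum-cong-≋ {m} y*r+y*v*r≈y*v+y*v ⟩
      ∑[ i < m ] (y i * v i + y i * v i)        ≈⟨ ∑-distrib-+ {m} (λ i → y i * v i) (λ i → y i * v i) ⟩
      T + T                                     ∎

    Ay+T₁≈1 : Ay + T₁ ≈ 1#
    Ay+T₁≈1 = trans (+-assoc 1# (- T₁) T₁) (trans (+-congˡ (-‿inverseˡ T₁)) (+-identityʳ 1#))

    δAy+B*T₂≈0 : δ Ay + B * T₂ ≈ 0#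
    δAy+B*T₂≈0 = begin
      δ Ay + B * T₂          ≈⟨ +-congʳ (trans (δ-1+ (- T₁)) (δ-‿homo T₁)) ⟩
      - δ T₁ + B * T₂        ≈⟨ +-congʳ (-‿cong δT₁≈B*T₂) ⟩
      - (B * T₂) + B * T₂    ≈⟨ -‿inverseˡ (B * T₂) ⟩
      0#                     ∎

    [S+S]*Ay+δAy+Ay≈1 : (S + S) * Ay + δ Ay + Ay ≈ 1#
    [S+S]*Ay+δAy+Ay≈1 = +-cancelʳ (S + S) _ 1# (begin
      (S + S) * Ay + δ Ay + Ay + (S + S)
        ≈⟨ +-congˡ (trans (+-cong S≈B*T S≈B*T) (trans (sym (distribˡ B T T)) (*-congˡ (sym T₁+T₂≈T+T)))) ⟩
      (S + S) * Ay + δ Ay + Ay + B * (T₁ + T₂)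
        ≈⟨ solve 5 (λ s a da t₁ t₂ → (s :+ s) :* a :+ da :+ a :+ (con 1 :+ (s :+ s)) :* (t₁ :+ t₂)
                                     := (con 1 :+ (s :+ s)) :* (a :+ t₁) :+ (da :+ (con 1 :+ (s :+ s)) :* t₂))
                 refl S Ay (δ Ay) T₁ T₂ ⟩
      B * (Ay + T₁) + (δ Ay + B * T₂)
        ≈⟨ +-cong (trans (*-congˡ Ay+T₁≈1) (*-identityʳ B)) δAy+B*T₂≈0 ⟩
      B + 0#
        ≈⟨ +-identityʳ B ⟩
      1# + (S + S) ∎)

    δ[Ey²*Ay]+Ey²*Ay≈Ey² : δ (Ey * Ey * Ay) + Ey * Ey * Ay ≈ Ey * Ey
    δ[Ey²*Ay]+Ey²*Ay≈Ey² = begin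
      δ (Ey² * Ay) + Ey² * Ay
        ≈⟨ +-congʳ (leibniz Ey² Ay) ⟩
      δ Ey² * Ay + Ey² * δ Ay + Ey² * Ay
        ≈⟨ +-congʳ (+-congʳ (*-congʳ δEy²≈Ey²*[S+S])) ⟩
      Ey² * (S + S) * Ay + Ey² * δ Ay + Ey² * Ay
        ≈⟨ solve 4 (λ p s a da → p :* (s :+ s) :* a :+ p :* da :+ p :* a := p :* ((s :+ s) :* a :+ da :+ a))
                 refl Ey² S Ay (δ Ay) ⟩
      Ey² * ((S + S) * Ay + δ Ay + Ay)
        ≈⟨ *-congˡ [S+S]*Ay+δAy+Ay≈1 ⟩
      Ey² * 1#
        ≈⟨ *-identityʳ Ey² ⟩
      Ey² ∎

-- The ring of power series

open import Data.Rational using (ℚ; 1ℚ; _+_; _*_; -_; _/_; mkℚ)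
import Data.Integer as ℤ
import Data.Integer.Properties as ℤP
import Data.Nat.Coprimality as Coprimality
open import Relation.Binary.PropositionalEquality using (refl; sym; trans; cong; cong₂; subst; subst₂)
open import Relation.Nullary using (yes; no)

module ℚR = CommutativeRing ℚP.+-*-commutativeRing
module ℚΣ = Sequences ℚP.+-*-commutativeRing
module ℚSum = SemiringSum ℚR.semiring
module ℚ+ = CommutativeSemigroupProperties ℚR.+-commutativeSemigroup
module ℕ+ = CommutativeSemigroupProperties ℕP.+-commutativeSemigroup

ℕtoℚ-suc : ∀ k → ℕtoℚ (suc k) ≡ 1ℚ + ℕtoℚ k
ℕtoℚ-suc k = begin
  ℕtoℚ (suc k)                            ≡⟨ cong (λ i → ((ℤ.+ 1) ℤ.+ i) / 1) (ℤP.*-identityʳ (ℤ.+ k)) ⟨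
  ((ℤ.+ 1) ℤ.+ (ℤ.+ k) ℤ.* (ℤ.+ 1)) / 1   ≡⟨⟩
  1ℚ + mkℚ (ℤ.+ k) 0 k-coprime-1          ≡⟨ cong (1ℚ +_) (ℚP.normalize-coprime k-coprime-1) ⟨
  1ℚ + ℕtoℚ k                             ∎
  where
  open ≡.≡-Reasoning
  k-coprime-1 : Coprimality.Coprime k 1
  k-coprime-1 = Coprimality.sym (Coprimality.1-coprimeTo k)

ℕtoℚ-+ : ∀ m n → ℕtoℚ (m ℕ.+ n) ≡ ℕtoℚ m + ℕtoℚ n
ℕtoℚ-+ zero    n = sym (ℚR.+-identityˡ (ℕtoℚ n))
ℕtoℚ-+ (suc m) n = begin
  ℕtoℚ (suc (m ℕ.+ n))      ≡⟨ ℕtoℚ-suc (m ℕ.+ n) ⟩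
  1ℚ + ℕtoℚ (m ℕ.+ n)       ≡⟨ cong (1ℚ +_) (ℕtoℚ-+ m n) ⟩
  1ℚ + (ℕtoℚ m + ℕtoℚ n)    ≡⟨ ℚR.+-assoc 1ℚ (ℕtoℚ m) (ℕtoℚ n) ⟨
  (1ℚ + ℕtoℚ m) + ℕtoℚ n    ≡⟨ cong (_+ ℕtoℚ n) (ℕtoℚ-suc m) ⟨
  ℕtoℚ (suc m) + ℕtoℚ n     ∎
  where open ≡.≡-Reasoning

0ₚ-coeff : ∀ {n} (α : Mono n) → 0ₚ α ≡ 0ℚ
0ₚ-coeff α with Vec.sum α
... | zero  = refl
... | suc _ = refl

constₚ-cong : ∀ {m n c} {α : Mono m} {β : Mono n} → Vec.sum α ≡ Vec.sum β → constₚ c α ≡ constₚ c β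
constₚ-cong {α = α} {β} |α|≡|β| with Vec.sum α | Vec.sum β
... | zero  | zero  = refl
... | suc _ | suc _ = refl
constₚ-cong () | zero  | suc _
constₚ-cong () | suc _ | zero

+ₚ-isAbelianGroup : ∀ {n} → IsAbelianGroup (_≈ₚ_ {n}) _+ₚ_ 0ₚ (-ₚ_)
+ₚ-isAbelianGroup = record
  { isGroup = record
    { isMonoid = record
      { isSemigroup = record
        { isMagma = record
          { isEquivalence = record
            { refl  = λ _ → refl
            ; sym   = λ f≈g α → sym (f≈g α)
            ; trans = λ f≈g g≈h α → trans (f≈g α) (g≈h α)
            }
          ; ∙-cong = λ f≈f′ g≈g′ α → cong₂ _+_ (f≈f′ α) (g≈g′ α)
          }
        ; assoc = λ f g h α → ℚR.+-assoc (f α) (g α) (h α)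
        }
      ; identity = (λ f α → trans (cong (_+ f α) (0ₚ-coeff α)) (ℚR.+-identityˡ (f α)))
                 , (λ f α → trans (cong (f α +_) (0ₚ-coeff α)) (ℚR.+-identityʳ (f α)))
      }
    ; inverse = (λ f α → trans (ℚR.-‿inverseˡ (f α)) (sym (0ₚ-coeff α)))
              , (λ f α → trans (ℚR.-‿inverseʳ (f α)) (sym (0ₚ-coeff α)))
    ; ⁻¹-cong = λ f≈g α → cong -_ (f≈g α)
    }
  ; comm = λ f g α → ℚR.+-comm (f α) (g α)
  }

sum-coeff : ∀ {n m} (F : Vector (PS n) m) α → Vector.foldr _+ₚ_ 0ₚ F α ≡ Vector.foldr _+_ 0ℚ (λ k → F k α)
sum-coeff {m = zero}  F α = 0ₚ-coeff α
sum-coeff {m = suc m} F α = cong (F Fin.zero α +_) (sum-coeff (F ∘ Fin.suc) α)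

sumL-++ : (xs ys : List ℚ) → sumL (xs List.++ ys) ≡ sumL xs + sumL ys
sumL-++ []       ys = sym (ℚR.+-identityˡ _)
sumL-++ (x ∷ xs) ys = trans (cong (x +_) (sumL-++ xs ys)) (sym (ℚR.+-assoc x _ _))

sumL-concatMap : ∀ {A B : Set} (F : B → ℚ) (G : A → List B) (xs : List A) →
                 sumL (List.map F (List.concatMap G xs)) ≡ sumL (List.map (λ x → sumL (List.map F (G x))) xs)
sumL-concatMap F G []       = refl
sumL-concatMap F G (x ∷ xs) =
  trans (cong sumL (map-++ F (G x) _))
        (trans (sumL-++ (List.map F (G x)) _) (cong (sumL (List.map F (G x)) +_) (sumL-concatMap F G xs)))

sumL-applyUpTo : ∀ (F : ℕ → ℚ) g n → sumL (List.map F (List.applyUpTo g n)) ≡ ℚΣ.Σ< n (F ∘ g)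
sumL-applyUpTo F g zero    = refl
sumL-applyUpTo F g (suc n) = cong (F (g 0) +_) (sumL-applyUpTo F (g ∘ suc) n)

sumL-cong-All : ∀ {A : Set} {F G : A → ℚ} {xs : List A} →
                All (λ x → F x ≡ G x) xs → sumL (List.map F xs) ≡ sumL (List.map G xs)
sumL-cong-All []       = refl
sumL-cong-All (e ∷ es) = cong₂ _+_ e (sumL-cong-All es)

sumL-zero-All : ∀ {A : Set} {F : A → ℚ} {xs : List A} → All (λ x → F x ≡ 0ℚ) xs → sumL (List.map F xs) ≡ 0ℚ
sumL-zero-All []       = refl
sumL-zero-All (e ∷ es) = cong₂ _+_ e (sumL-zero-All es)

sumL-+ : ∀ {A : Set} (F G : A → ℚ) (xs : List A) →
         sumL (List.map (λ x → F x + G x) xs) ≡ sumL (List.map F xs) + sumL (List.map G xs)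
sumL-+ F G []       = sym (ℚR.+-identityˡ 0ℚ)
sumL-+ F G (x ∷ xs) = trans (cong ((F x + G x) +_) (sumL-+ F G xs)) (ℚ+.interchange (F x) (G x) _ _)

sumL-*ˡ : ∀ {A : Set} c (F : A → ℚ) (xs : List A) → sumL (List.map (λ x → c * F x) xs) ≡ c * sumL (List.map F xs)
sumL-*ˡ c F []       = sym (ℚR.zeroʳ c)
sumL-*ˡ c F (x ∷ xs) = trans (cong (c * F x +_) (sumL-*ˡ c F xs)) (sym (ℚR.distribˡ c (F x) _))

slice : ∀ {n} → PS (suc n) → ℕ → PS n
slice f a α = f (a ∷ α)

*ₚ-slice : ∀ {n} (f g : PS (suc n)) a α → (f *ₚ g) (a ∷ α) ≡ ℚΣ.Σ< (suc a) (λ k → (slice f k *ₚ slice g (a ∸ k)) α)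
*ₚ-slice f g a α = begin
  (f *ₚ g) (a ∷ α)
    ≡⟨ trans (sumL-concatMap _ (λ k → List.map (λ { (β , γ) → (k ∷ β , (a ∸ k) ∷ γ) }) (splits α)) (List.upTo (suc a)))
             (cong sumL (map-cong (λ k → cong sumL (sym (map-∘ (splits α)))) (List.upTo (suc a)))) ⟩
  sumL (List.map (λ k → (slice f k *ₚ slice g (a ∸ k)) α) (List.upTo (suc a)))
    ≡⟨ sumL-applyUpTo (λ k → (slice f k *ₚ slice g (a ∸ k)) α) (λ k → k) (suc a) ⟩
  ℚΣ.Σ< (suc a) (λ k → (slice f k *ₚ slice g (a ∸ k)) α) ∎
  where open ≡.≡-Reasoning

*ₚ-cong : ∀ {n} {f f′ g g′ : PS n} → f ≈ₚ f′ → g ≈ₚ g′ → f *ₚ g ≈ₚ f′ *ₚ g′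
*ₚ-cong f≈f′ g≈g′ α = cong sumL (map-cong (λ { (β , γ) → cong₂ _*_ (f≈f′ β) (g≈g′ γ) }) (splits α))

*ₚ-coeff₀ : (f g : PS 0) → (f *ₚ g) [] ≡ f [] * g []
*ₚ-coeff₀ f g = ℚR.+-identityʳ (f [] * g [])

slice-1ₚ-zero : ∀ {n} → slice {n} 1ₚ 0 ≈ₚ 1ₚ
slice-1ₚ-zero β = constₚ-cong {c = 1ℚ} {α = 0 ∷ β} {β} refl

slice-1ₚ-suc : ∀ {n} k → slice {n} 1ₚ (suc k) ≈ₚ 0ₚ
slice-1ₚ-suc k β = sym (0ₚ-coeff β)

module _ {n : ℕ} where
  open import Algebra.Definitions (_≈ₚ_ {n})

  isCommutativeRing-fromLaws : Associative _*ₚ_ → Commutative _*ₚ_ → LeftIdentity 1ₚ _*ₚ_ → _*ₚ_ DistributesOverʳ _+ₚ_ →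
                               IsCommutativeRing _≈ₚ_ _+ₚ_ _*ₚ_ (-ₚ_) 0ₚ 1ₚ
  isCommutativeRing-fromLaws assoc comm identityˡ distribʳ = record
    { isRing = record
      { +-isAbelianGroup = +ₚ-isAbelianGroup
      ; *-cong           = *ₚ-cong
      ; *-assoc          = assoc
      ; *-identity       = identityˡ , λ f α → trans (comm f 1ₚ α) (identityˡ f α)
      ; distrib          = (λ f g h α → trans (comm f (g +ₚ h) α)
                                              (trans (distribʳ f g h α) (cong₂ _+_ (comm g f α) (comm h f α))))
                         , distribʳ
      }
    ; *-comm = comm
    }

psRing : ∀ {n} → IsCommutativeRing (_≈ₚ_ {n}) _+ₚ_ _*ₚ_ (-ₚ_) 0ₚ 1ₚ → CommutativeRing 0ℓ 0ℓ
psRing {n} isCR = record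
  { Carrier = PS n ; _≈_ = _≈ₚ_ ; _+_ = _+ₚ_ ; _*_ = _*ₚ_ ; -_ = -ₚ_ ; 0# = 0ₚ ; 1# = 1ₚ
  ; isCommutativeRing = isCR
  }

*ₚ-isCommutativeRing₀ : IsCommutativeRing (_≈ₚ_ {0}) _+ₚ_ _*ₚ_ (-ₚ_) 0ₚ 1ₚ
*ₚ-isCommutativeRing₀ = isCommutativeRing-fromLaws assoc comm identityˡ distribʳ
  where
  open ≡.≡-Reasoning
  assoc : ∀ f g h → (f *ₚ g) *ₚ h ≈ₚ f *ₚ (g *ₚ h)
  assoc f g h [] = begin
    ((f *ₚ g) *ₚ h) []     ≡⟨ trans (*ₚ-coeff₀ (f *ₚ g) h) (cong (_* h []) (*ₚ-coeff₀ f g)) ⟩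
    (f [] * g []) * h []   ≡⟨ ℚR.*-assoc (f []) (g []) (h []) ⟩
    f [] * (g [] * h [])   ≡⟨ trans (*ₚ-coeff₀ f (g *ₚ h)) (cong (f [] *_) (*ₚ-coeff₀ g h)) ⟨
    (f *ₚ (g *ₚ h)) []     ∎
  comm : ∀ f g → f *ₚ g ≈ₚ g *ₚ f
  comm f g [] = trans (*ₚ-coeff₀ f g) (trans (ℚR.*-comm (f []) (g [])) (sym (*ₚ-coeff₀ g f)))
  identityˡ : ∀ f → 1ₚ *ₚ f ≈ₚ f
  identityˡ f [] = trans (*ₚ-coeff₀ 1ₚ f) (ℚR.*-identityˡ (f []))
  distribʳ : ∀ h f g → (f +ₚ g) *ₚ h ≈ₚ f *ₚ h +ₚ g *ₚ h
  distribʳ h f g [] =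
    trans (*ₚ-coeff₀ (f +ₚ g) h)
          (trans (ℚR.distribʳ (h []) (f []) (g [])) (sym (cong₂ _+_ (*ₚ-coeff₀ f h) (*ₚ-coeff₀ g h))))

module SliceRing {n} (isCR : IsCommutativeRing (_≈ₚ_ {n}) _+ₚ_ _*ₚ_ (-ₚ_) 0ₚ 1ₚ) where
  open Sequences (psRing isCR)
  open ≡.≡-Reasoning

  *ₚ-⊛ : ∀ (f g : PS (suc n)) a → slice (f *ₚ g) a ≈ₚ (slice f ⊛ slice g) a
  *ₚ-⊛ f g a α = trans (*ₚ-slice f g a α) (sym (sum-coeff {m = suc a} (λ k → slice f (toℕ k) *ₚ slice g (a ∸ toℕ k)) α))

  *ₚ-assoc : ∀ (f g h : PS (suc n)) → (f *ₚ g) *ₚ h ≈ₚ f *ₚ (g *ₚ h)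
  *ₚ-assoc f g h (a ∷ α) = begin
    ((f *ₚ g) *ₚ h) (a ∷ α)               ≡⟨ *ₚ-⊛ (f *ₚ g) h a α ⟩
    (slice (f *ₚ g) ⊛ slice h) a α        ≡⟨ ⊛-congˡ (slice h) (*ₚ-⊛ f g) a α ⟩
    ((slice f ⊛ slice g) ⊛ slice h) a α   ≡⟨ ⊛-assoc (slice f) (slice g) (slice h) a α ⟩
    (slice f ⊛ (slice g ⊛ slice h)) a α   ≡⟨ ⊛-congʳ (slice f) (*ₚ-⊛ g h) a α ⟨
    (slice f ⊛ slice (g *ₚ h)) a α        ≡⟨ *ₚ-⊛ f (g *ₚ h) a α ⟨
    (f *ₚ (g *ₚ h)) (a ∷ α)               ∎

  *ₚ-comm : ∀ (f g : PS (suc n)) → f *ₚ g ≈ₚ g *ₚ f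
  *ₚ-comm f g (a ∷ α) = trans (*ₚ-⊛ f g a α) (trans (⊛-comm (slice f) (slice g) a α) (sym (*ₚ-⊛ g f a α)))

  *ₚ-identityˡ : ∀ (f : PS (suc n)) → 1ₚ *ₚ f ≈ₚ f
  *ₚ-identityˡ f (a ∷ α) = trans (*ₚ-⊛ 1ₚ f a α) (⊛-identityˡ (slice 1ₚ) (slice f) slice-1ₚ-zero slice-1ₚ-suc a α)

  *ₚ-distribʳ : ∀ (h f g : PS (suc n)) → (f +ₚ g) *ₚ h ≈ₚ f *ₚ h +ₚ g *ₚ h
  *ₚ-distribʳ h f g (a ∷ α) =
    trans (*ₚ-⊛ (f +ₚ g) h a α)
          (trans (⊛-distribʳ (slice f) (slice g) (slice h) a α) (sym (cong₂ _+_ (*ₚ-⊛ f h a α) (*ₚ-⊛ g h a α))))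

  isCommutativeRing : IsCommutativeRing (_≈ₚ_ {suc n}) _+ₚ_ _*ₚ_ (-ₚ_) 0ₚ 1ₚ
  isCommutativeRing = isCommutativeRing-fromLaws *ₚ-assoc *ₚ-comm *ₚ-identityˡ *ₚ-distribʳ

*ₚ-isCommutativeRing : ∀ n → IsCommutativeRing (_≈ₚ_ {n}) _+ₚ_ _*ₚ_ (-ₚ_) 0ₚ 1ₚ
*ₚ-isCommutativeRing zero    = *ₚ-isCommutativeRing₀
*ₚ-isCommutativeRing (suc n) = SliceRing.isCommutativeRing (*ₚ-isCommutativeRing n)

PSR : ℕ → CommutativeRing 0ℓ 0ℓ
PSR n = psRing (*ₚ-isCommutativeRing n)

-- The Euler operator

DegreeSplit : ∀ {n} → Mono n → Mono n × Mono n → Set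
DegreeSplit α (β , γ) = Vec.sum β ℕ.+ Vec.sum γ ≡ Vec.sum α

splits-degree : ∀ {n} (α : Mono n) → All (DegreeSplit α) (splits α)
splits-degree []      = refl ∷ []
splits-degree (a ∷ α) =
  concat⁺ (map⁺ (applyUpTo⁺₁ (λ k → k) (suc a) (λ k<1+a → map⁺ (All.map (λ {p} → extend k<1+a {p}) (splits-degree α)))))
  where
  extend : ∀ {k} → k ℕ.< suc a → ∀ {p} → DegreeSplit α p → DegreeSplit (a ∷ α) (k ∷ proj₁ p , (a ∸ k) ∷ proj₂ p)
  extend {k} k<1+a {β , γ} |β|+|γ|≡|α| =
    trans (ℕ+.interchange k (Vec.sum β) (a ∸ k) (Vec.sum γ)) (cong₂ ℕ._+_ (ℕP.m+[n∸m]≡n (ℕP.≤-pred k<1+a)) |β|+|γ|≡|α|)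

euler : ∀ {n} → PS n → PS n
euler f α = ℕtoℚ (Vec.sum α) * f α

euler-leibniz : ∀ {n} (f g : PS n) → euler (f *ₚ g) ≈ₚ euler f *ₚ g +ₚ f *ₚ euler g
euler-leibniz f g α = begin
  ℕtoℚ (Vec.sum α) * sumL (List.map (λ { (β , γ) → f β * g γ }) (splits α))
    ≡⟨ sumL-*ˡ (ℕtoℚ (Vec.sum α)) _ (splits α) ⟨
  sumL (List.map (λ { (β , γ) → ℕtoℚ (Vec.sum α) * (f β * g γ) }) (splits α))
    ≡⟨ sumL-cong-All (All.map (λ {p} → distribute p) (splits-degree α)) ⟩
  sumL (List.map (λ { (β , γ) → euler f β * g γ + f β * euler g γ }) (splits α))
    ≡⟨ sumL-+ (λ { (β , γ) → euler f β * g γ }) (λ { (β , γ) → f β * euler g γ }) (splits α) ⟩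
  (euler f *ₚ g +ₚ f *ₚ euler g) α ∎
  where
  open ≡.≡-Reasoning
  open NatCoeffSolver ℚR.commutativeSemiring using (solve; _:+_; _:*_; _:=_)
  distribute : ∀ p → DegreeSplit α p →
               ℕtoℚ (Vec.sum α) * (f (proj₁ p) * g (proj₂ p)) ≡ euler f (proj₁ p) * g (proj₂ p) + f (proj₁ p) * euler g (proj₂ p)
  distribute (β , γ) |β|+|γ|≡|α| = begin
    ℕtoℚ (Vec.sum α) * (f β * g γ)
      ≡⟨ cong (λ d → ℕtoℚ d * (f β * g γ)) |β|+|γ|≡|α| ⟨
    ℕtoℚ (Vec.sum β ℕ.+ Vec.sum γ) * (f β * g γ)
      ≡⟨ cong (_* (f β * g γ)) (ℕtoℚ-+ (Vec.sum β) (Vec.sum γ)) ⟩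
    (ℕtoℚ (Vec.sum β) + ℕtoℚ (Vec.sum γ)) * (f β * g γ)
      ≡⟨ solve 4 (λ b c x y → (b :+ c) :* (x :* y) := (b :* x) :* y :+ x :* (c :* y))
               refl (ℕtoℚ (Vec.sum β)) (ℕtoℚ (Vec.sum γ)) (f β) (g γ) ⟩
    euler f β * g γ + f β * euler g γ ∎

euler-isDerivation : ∀ {n} → IsDerivation (PSR n) euler
euler-isDerivation = record
  { cong    = λ f≈g α → cong (ℕtoℚ (Vec.sum α) *_) (f≈g α)
  ; +-homo  = λ f g α → ℚR.distribˡ (ℕtoℚ (Vec.sum α)) (f α) (g α)
  ; leibniz = euler-leibniz
  }

var-coeff : ∀ {n} (i : Fin n) α → var i α ≡ 0ℚ ⊎ Vec.sum α ≡ 1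
var-coeff Fin.zero    (zero ∷ α)        = inj₁ refl
var-coeff Fin.zero    (suc (suc a) ∷ α) = inj₁ refl
var-coeff Fin.zero    (suc zero ∷ α) with Vec.sum α
... | zero  = inj₂ refl
... | suc _ = inj₁ refl
var-coeff (Fin.suc i) (zero ∷ α)        = var-coeff i α
var-coeff (Fin.suc i) (suc a ∷ α)       = inj₁ refl

euler-var : ∀ {n} (i : Fin n) → euler (var i) ≈ₚ var i
euler-var i α with var-coeff i α
... | inj₁ xᵢ[α]≡0 = trans (cong (ℕtoℚ (Vec.sum α) *_) xᵢ[α]≡0) (trans (ℚR.zeroʳ (ℕtoℚ (Vec.sum α))) (sym xᵢ[α]≡0))
... | inj₂ |α|≡1   = trans (cong (λ d → ℕtoℚ d * var i α) |α|≡1) (ℚR.*-identityˡ (var i α))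

module _ {n : ℕ} where
  private module Rₙ = CommutativeRing (PSR n)
  open Sequences (PSR n)
  open SliceRing (*ₚ-isCommutativeRing n) using (*ₚ-⊛)
  open ≡.≡-Reasoning

  slice-var₀-0 : slice (var {suc n} Fin.zero) 0 ≈ₚ 0ₚ
  slice-var₀-0 β = sym (0ₚ-coeff β)

  slice-var₀-1 : slice (var {suc n} Fin.zero) 1 ≈ₚ 1ₚ
  slice-var₀-1 β with Vec.sum β
  ... | zero  = refl
  ... | suc _ = refl

  slice-var₀-2+ : ∀ k → slice (var {suc n} Fin.zero) (suc (suc k)) ≈ₚ 0ₚ
  slice-var₀-2+ k β = sym (0ₚ-coeff β)

  slice-varₛ-suc : ∀ (i : Fin n) k → slice (var (Fin.suc i)) (suc k) ≈ₚ 0ₚ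
  slice-varₛ-suc i k β = sym (0ₚ-coeff β)

  var₀*ₚ-coeff₀ : ∀ (h : PS (suc n)) α → (var Fin.zero *ₚ h) (0 ∷ α) ≡ 0ℚ
  var₀*ₚ-coeff₀ h α = begin
    (var Fin.zero *ₚ h) (0 ∷ α)
      ≡⟨ *ₚ-⊛ (var Fin.zero) h 0 α ⟩
    (slice (var Fin.zero) ⊛ slice h) 0 α
      ≡⟨ Rₙ.trans (⊛-zero (slice (var Fin.zero)) (slice h)) (Rₙ.trans (Rₙ.*-congʳ slice-var₀-0) (Rₙ.zeroˡ (slice h 0))) α ⟩
    0ₚ α
      ≡⟨ 0ₚ-coeff α ⟩
    0ℚ ∎

  var₀*ₚ-coeffₛ : ∀ (h : PS (suc n)) a α → (var Fin.zero *ₚ h) (suc a ∷ α) ≡ h (a ∷ α)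
  var₀*ₚ-coeffₛ h a α = begin
    (var Fin.zero *ₚ h) (suc a ∷ α)
      ≡⟨ *ₚ-⊛ (var Fin.zero) h (suc a) α ⟩
    (slice (var Fin.zero) ⊛ slice h) (suc a) α
      ≡⟨ ⊛-shiftˡ (slice (var Fin.zero)) (slice h) slice-var₀-0 a α ⟩
    ((slice (var Fin.zero) ∘ suc) ⊛ slice h) a α
      ≡⟨ ⊛-identityˡ (slice (var Fin.zero) ∘ suc) (slice h) slice-var₀-1 slice-var₀-2+ a α ⟩
    h (a ∷ α) ∎

  varₛ*ₚ-coeff : ∀ (i : Fin n) (h : PS (suc n)) a α → (var (Fin.suc i) *ₚ h) (a ∷ α) ≡ (var i *ₚ slice h a) α
  varₛ*ₚ-coeff i h a α =
    trans (*ₚ-⊛ (var (Fin.suc i)) h a α) (⊛-headˡ (slice (var (Fin.suc i))) (slice h) (slice-varₛ-suc i) a α)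

var*ₚ∂-coeff : ∀ {n} (i : Fin n) (f : PS n) α → (var i *ₚ ∂ i f) α ≡ ℕtoℚ (Vec.lookup α i) * f α
var*ₚ∂-coeff Fin.zero    f (zero ∷ α)  = trans (var₀*ₚ-coeff₀ (∂ Fin.zero f) α) (sym (ℚR.zeroˡ (f (0 ∷ α))))
var*ₚ∂-coeff Fin.zero    f (suc a ∷ α) = var₀*ₚ-coeffₛ (∂ Fin.zero f) a α
var*ₚ∂-coeff (Fin.suc i) f (a ∷ α)     = trans (varₛ*ₚ-coeff i (∂ (Fin.suc i) f) a α) (var*ₚ∂-coeff i (slice f a) α)

sumFin≡foldr : ∀ {n m} (F : Vector (PS n) m) → sumFin F ≡ Vector.foldr _+ₚ_ 0ₚ F
sumFin≡foldr {m = zero}  F = refl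
sumFin≡foldr {m = suc m} F = cong (F Fin.zero +ₚ_) (sumFin≡foldr (F ∘ Fin.suc))

prodFin≡foldr : ∀ {n m} (F : Vector (PS n) m) → prodFin F ≡ Vector.foldr _*ₚ_ 1ₚ F
prodFin≡foldr {m = zero}  F = refl
prodFin≡foldr {m = suc m} F = cong (F Fin.zero *ₚ_) (prodFin≡foldr (F ∘ Fin.suc))

∑-lookup : ∀ {n} (α : Mono n) c → Vector.foldr _+_ 0ℚ (λ i → ℕtoℚ (Vec.lookup α i) * c) ≡ ℕtoℚ (Vec.sum α) * c
∑-lookup []      c = sym (ℚR.zeroˡ c)
∑-lookup (a ∷ α) c = begin
  ℕtoℚ a * c + Vector.foldr _+_ 0ℚ (λ i → ℕtoℚ (Vec.lookup α i) * c)   ≡⟨ cong (ℕtoℚ a * c +_) (∑-lookup α c) ⟩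
  ℕtoℚ a * c + ℕtoℚ (Vec.sum α) * c                                     ≡⟨ ℚR.distribʳ c (ℕtoℚ a) (ℕtoℚ (Vec.sum α)) ⟨
  (ℕtoℚ a + ℕtoℚ (Vec.sum α)) * c                                       ≡⟨ cong (_* c) (ℕtoℚ-+ a (Vec.sum α)) ⟨
  ℕtoℚ (a ℕ.+ Vec.sum α) * c                                            ∎
  where open ≡.≡-Reasoning

Dx≈euler : ∀ {n} (f : PS n) → Dx f ≈ₚ euler f
Dx≈euler {n} f α = begin
  sumFin (λ i → var i *ₚ ∂ i f) α                           ≡⟨ cong (λ g → g α) (sumFin≡foldr (λ i → var i *ₚ ∂ i f)) ⟩
  Vector.foldr _+ₚ_ 0ₚ (λ i → var i *ₚ ∂ i f) α             ≡⟨ sum-coeff (λ i → var i *ₚ ∂ i f) α ⟩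
  Vector.foldr _+_ 0ℚ (λ i → (var i *ₚ ∂ i f) α)            ≡⟨ ℚSum.sum-cong-≗ {n} (λ i → var*ₚ∂-coeff i f α) ⟩
  Vector.foldr _+_ 0ℚ (λ i → ℕtoℚ (Vec.lookup α i) * f α)   ≡⟨ ∑-lookup α (f α) ⟩
  euler f α                                                 ∎
  where open ≡.≡-Reasoning

-- Reciprocals

sum-replicate-0 : ∀ n → Vec.sum (Vec.replicate n 0) ≡ 0
sum-replicate-0 zero    = refl
sum-replicate-0 (suc n) = sum-replicate-0 n

sum≡0⇒replicate-0 : ∀ {n} (β : Mono n) → Vec.sum β ≡ 0 → β ≡ Vec.replicate n 0
sum≡0⇒replicate-0 []      _      = refl
sum≡0⇒replicate-0 (b ∷ β) |bβ|≡0 = cong₂ _∷_ (ℕP.m+n≡0⇒m≡0 b |bβ|≡0) (sum≡0⇒replicate-0 β (ℕP.m+n≡0⇒n≡0 b |bβ|≡0))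

const-coeff-1ₚ : ∀ {n} → const-coeff {n} 1ₚ ≡ 1ℚ
const-coeff-1ₚ {n} = constₚ-cong {c = 1ℚ} {α = Vec.replicate n 0} {β = []} (sum-replicate-0 n)

const-coeff-*ₚ : ∀ {n} (f g : PS n) → const-coeff (f *ₚ g) ≡ const-coeff f * const-coeff g
const-coeff-*ₚ {zero}  f g = *ₚ-coeff₀ f g
const-coeff-*ₚ {suc n} f g =
  trans (*ₚ-⊛ f g 0 zeros) (trans (⊛-zero (slice f) (slice g) zeros) (const-coeff-*ₚ (slice f 0) (slice g 0)))
  where
  open Sequences (PSR n)
  open SliceRing (*ₚ-isCommutativeRing n) using (*ₚ-⊛)
  zeros : Mono n
  zeros = Vec.replicate n 0

const-coeff-1+ : ∀ {n} (h : PS n) → const-coeff h ≡ 0ℚ → const-coeff (1ₚ +ₚ h) ≡ 1ℚ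
const-coeff-1+ {n} h h₀≡0 = trans (cong₂ _+_ (const-coeff-1ₚ {n}) h₀≡0) (ℚR.+-identityʳ 1ℚ)

const-coeff-prodFin : ∀ {n m} (F : Vector (PS n) m) → (∀ j → const-coeff (F j) ≡ 1ℚ) → const-coeff (prodFin F) ≡ 1ℚ
const-coeff-prodFin {n} {zero}  F F₀≡1 = const-coeff-1ₚ {n}
const-coeff-prodFin {n} {suc m} F F₀≡1 =
  trans (const-coeff-*ₚ (F Fin.zero) (prodFin (F ∘ Fin.suc)))
        (trans (cong₂ _*_ (F₀≡1 Fin.zero) (const-coeff-prodFin (F ∘ Fin.suc) (F₀≡1 ∘ Fin.suc))) (ℚR.*-identityʳ 1ℚ))

OrderAtLeast : ∀ {n} → ℕ → PS n → Set
OrderAtLeast k f = ∀ β → Vec.sum β ℕ.< k → f β ≡ 0ℚ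

const-coeff≡0⇒order-1 : ∀ {n} (h : PS n) → const-coeff h ≡ 0ℚ → OrderAtLeast 1 h
const-coeff≡0⇒order-1 h h₀≡0 β |β|<1 = trans (cong h (sum≡0⇒replicate-0 β (ℕP.n<1⇒n≡0 |β|<1))) h₀≡0

-ₚ-order : ∀ {n k} {f : PS n} → OrderAtLeast k f → OrderAtLeast k (-ₚ f)
-ₚ-order f-order β |β|<k = cong -_ (f-order β |β|<k)

*ₚ-order : ∀ {n k l} {f g : PS n} → OrderAtLeast k f → OrderAtLeast l g → OrderAtLeast (k ℕ.+ l) (f *ₚ g)
*ₚ-order {k = k} {l} {f} {g} f-order g-order α |α|<k+l =
  sumL-zero-All (All.map (λ {p} → vanishes p) (splits-degree α))
  where
  vanishes : ∀ p → DegreeSplit α p → f (proj₁ p) * g (proj₂ p) ≡ 0ℚ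
  vanishes (β , γ) |β|+|γ|≡|α| with Vec.sum β ℕ.<? k
  ... | yes |β|<k = trans (cong (_* g γ) (f-order β |β|<k)) (ℚR.zeroˡ (g γ))
  ... | no  |β|≮k = trans (cong (f β *_) (g-order γ |γ|<l)) (ℚR.zeroʳ (f β))
    where
    |γ|<l : Vec.sum γ ℕ.< l
    |γ|<l = ℕP.+-cancelˡ-< k (Vec.sum γ) l
              (ℕP.≤-<-trans (ℕP.+-monoˡ-≤ (Vec.sum γ) (ℕP.≮⇒≥ |β|≮k)) (subst (ℕ._< k ℕ.+ l) (sym |β|+|γ|≡|α|) |α|<k+l))

^ₚ-order : ∀ {n} {u : PS n} → OrderAtLeast 1 u → ∀ k → OrderAtLeast k (u ^ₚ k)
^ₚ-order u-order zero    γ ()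
^ₚ-order u-order (suc k) = *ₚ-order u-order (^ₚ-order u-order k)

module _ {n : ℕ} (h : PS n) (h₀≡0 : const-coeff h ≡ 0ℚ) where
  private module Rₙ = CommutativeRing (PSR n)
  open Sequences (PSR n)
  open import Algebra.Properties.Ring Rₙ.ring using (-‿involutive)
  open ≡.≡-Reasoning

  private
    U : ℕ → PS n
    U k = (-ₚ h) ^ₚ k

    U-order : ∀ k → OrderAtLeast k (U k)
    U-order = ^ₚ-order (-ₚ-order (const-coeff≡0⇒order-1 h h₀≡0))

  -- inv1p h γ is the partial sum over k ≤ |γ|; the terms with k > |γ| vanish at γ by U-order
  inv1p-coeff : ∀ M γ → Vec.sum γ ℕ.< M → inv1p h γ ≡ Σ< M U γ
  inv1p-coeff M γ |γ|<M = begin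
    inv1p h γ
      ≡⟨ sumL-applyUpTo (λ k → U k γ) (λ k → k) (suc |γ|) ⟩
    ℚΣ.Σ< (suc |γ|) (λ k → U k γ)
      ≡⟨ ℚΣ.Σ<-truncate (suc |γ|) (M ∸ suc |γ|) (λ k → U k γ) (λ k → U-order k γ) ⟨
    ℚΣ.Σ< (suc |γ| ℕ.+ (M ∸ suc |γ|)) (λ k → U k γ)
      ≡⟨ cong (λ M′ → ℚΣ.Σ< M′ (λ k → U k γ)) (ℕP.m+[n∸m]≡n |γ|<M) ⟩
    ℚΣ.Σ< M (λ k → U k γ)
      ≡⟨ sum-coeff {m = M} (U ∘ toℕ) γ ⟨
    Σ< M U γ ∎
    where
    |γ| : ℕ
    |γ| = Vec.sum γ

  inv1p-inverse : (1ₚ +ₚ h) *ₚ inv1p h ≈ₚ 1ₚ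
  inv1p-inverse α = begin
    ((1ₚ +ₚ h) *ₚ inv1p h) α
      ≡⟨ sumL-cong-All (All.map (λ {p} → truncate p) (splits-degree α)) ⟩
    ((1ₚ +ₚ h) *ₚ Σ< M U) α
      ≡⟨ ℚR.+-identityʳ _ ⟨
    ((1ₚ +ₚ h) *ₚ Σ< M U) α + 0ℚ
      ≡⟨ cong (((1ₚ +ₚ h) *ₚ Σ< M U) α +_) (U-order M α (ℕP.n<1+n (Vec.sum α))) ⟨
    ((1ₚ +ₚ h) *ₚ Σ< M U +ₚ U M) α
      ≡⟨ Rₙ.trans (Rₙ.+-congʳ (Rₙ.*-congʳ {Σ< M U} (Rₙ.+-congˡ {1ₚ} (Rₙ.sym (-‿involutive h)))))
                  (geometric-sum (-ₚ h) U Rₙ.refl (λ _ → Rₙ.refl) M) α ⟩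
    1ₚ α ∎
    where
    M : ℕ
    M = suc (Vec.sum α)
    truncate : ∀ p → DegreeSplit α p → (1ₚ +ₚ h) (proj₁ p) * inv1p h (proj₂ p) ≡ (1ₚ +ₚ h) (proj₁ p) * Σ< M U (proj₂ p)
    truncate (β , γ) |β|+|γ|≡|α| =
      cong ((1ₚ +ₚ h) β *_) (inv1p-coeff M γ (s≤s (subst (Vec.sum γ ℕ.≤_) |β|+|γ|≡|α| (ℕP.m≤n+m (Vec.sum γ) (Vec.sum β)))))

recipₚ-inverse : ∀ {n} (f : PS n) → const-coeff f ≡ 1ℚ → f *ₚ recipₚ f ≈ₚ 1ₚ
recipₚ-inverse {n} f f₀≡1 = Rₙ.trans (Rₙ.*-congʳ (Rₙ.sym 1+[f-1]≈f)) (inv1p-inverse (f -ₚ 1ₚ) [f-1]₀≡0)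
  where
  module Rₙ = CommutativeRing (PSR n)
  open import Algebra.Properties.AbelianGroup Rₙ.+-abelianGroup using (xyx⁻¹≈y)
  1+[f-1]≈f : 1ₚ +ₚ (f -ₚ 1ₚ) ≈ₚ f
  1+[f-1]≈f = Rₙ.trans (Rₙ.sym (Rₙ.+-assoc 1ₚ f (-ₚ 1ₚ))) (xyx⁻¹≈y 1ₚ f)
  [f-1]₀≡0 : const-coeff (f -ₚ 1ₚ) ≡ 0ℚ
  [f-1]₀≡0 = trans (cong₂ (λ a b → a + - b) f₀≡1 (const-coeff-1ₚ {n})) (ℚR.-‿inverseʳ 1ℚ)

f≈g*recip[e]⇒f*e≈g : ∀ {n} {f g e : PS n} → const-coeff e ≡ 1ℚ → f ≈ₚ g *ₚ recipₚ e → f *ₚ e ≈ₚ g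
f≈g*recip[e]⇒f*e≈g {n} {f} {g} {e} e₀≡1 f≈g*recip[e] = begin
  f *ₚ e                  ≈⟨ Rₙ.*-congʳ f≈g*recip[e] ⟩
  g *ₚ recipₚ e *ₚ e      ≈⟨ Rₙ.*-assoc g (recipₚ e) e ⟩
  g *ₚ (recipₚ e *ₚ e)    ≈⟨ Rₙ.*-congˡ {g} (Rₙ.trans (Rₙ.*-comm (recipₚ e) e) (recipₚ-inverse e e₀≡1)) ⟩
  g *ₚ 1ₚ                 ≈⟨ Rₙ.*-identityʳ g ⟩
  g                       ∎
  where
  module Rₙ = CommutativeRing (PSR n)
  open SetoidReasoning Rₙ.setoid

lemma12 : (r : ℕ) (y : Fin (suc r) → PS (suc r))
          → (∀ i → const-coeff (y i) ≡ 0ℚ)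
          → (∀ i → var i ≈ₚ (y i *ₚ (1ₚ +ₚ y i)) *ₚ recipₚ (E y *ₚ E y))
          → (Dx (E y *ₚ E y *ₚ A y) +ₚ Ix (E y *ₚ E y *ₚ A y)) ≈ₚ E y *ₚ E y
lemma12 r y y₀≡0 x≈y[1+y]*recip[E²] α =
  trans (cong (_+ (E y *ₚ E y *ₚ A y) α) (Dx≈euler (E y *ₚ E y *ₚ A y) α)) (euler-identity α)
  where
  [1+y]₀≡1 : ∀ i → const-coeff (1ₚ +ₚ y i) ≡ 1ℚ
  [1+y]₀≡1 i = const-coeff-1+ (y i) (y₀≡0 i)

  [1+2y]₀≡1 : ∀ i → const-coeff (1ₚ +ₚ (y i +ₚ y i)) ≡ 1ℚ
  [1+2y]₀≡1 i = const-coeff-1+ (y i +ₚ y i) (trans (cong₂ _+_ (y₀≡0 i) (y₀≡0 i)) (ℚR.+-identityʳ 0ℚ))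

  E²₀≡1 : const-coeff (E y *ₚ E y) ≡ 1ℚ
  E²₀≡1 = trans (const-coeff-*ₚ (E y) (E y)) (trans (cong₂ _*_ E₀≡1 E₀≡1) (ℚR.*-identityʳ 1ℚ))
    where
    E₀≡1 : const-coeff (E y) ≡ 1ℚ
    E₀≡1 = const-coeff-prodFin (λ j → 1ₚ +ₚ y j) [1+y]₀≡1

  E≡∏ : E y ≡ Vector.foldr _*ₚ_ 1ₚ (λ j → 1ₚ +ₚ y j)
  E≡∏ = prodFin≡foldr (λ j → 1ₚ +ₚ y j)

  A≡1-∑ : A y ≡ 1ₚ -ₚ Vector.foldr _+ₚ_ 0ₚ (λ i → y i *ₚ recipₚ (1ₚ +ₚ y i))
  A≡1-∑ = cong (λ s → 1ₚ -ₚ s) (sumFin≡foldr (λ i → y i *ₚ recipₚ (1ₚ +ₚ y i)))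

  euler-identity : euler (E y *ₚ E y *ₚ A y) +ₚ E y *ₚ E y *ₚ A y ≈ₚ E y *ₚ E y
  euler-identity = subst₂ (λ e a → euler (e *ₚ e *ₚ a) +ₚ e *ₚ e *ₚ a ≈ₚ e *ₚ e) (sym E≡∏) (sym A≡1-∑)
    (EulerIdentity.δ[Ey²*Ay]+Ey²*Ay≈Ey² euler-isDerivation var y
      (λ i → recipₚ (1ₚ +ₚ y i)) (λ i → recipₚ (1ₚ +ₚ (y i +ₚ y i)))
      (λ i → recipₚ-inverse (1ₚ +ₚ y i) ([1+y]₀≡1 i)) (λ i → recipₚ-inverse (1ₚ +ₚ (y i +ₚ y i)) ([1+2y]₀≡1 i))
      euler-var
      (subst (λ e → ∀ i → var i *ₚ (e *ₚ e) ≈ₚ y i *ₚ (1ₚ +ₚ y i)) E≡∏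
             (λ i → f≈g*recip[e]⇒f*e≈g E²₀≡1 (x≈y[1+y]*recip[E²] i))))
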